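{- Let $n$ be a positive integer and $q$ a prime power, both fixed. For a positive integer $k$, let $a(n,k,q)$ be the number of orbits of $GL_n(\mathbb{F}_q)$ acting by simultaneous conjugation $g\cdot(A_1,\ldots,A_k) = (gA_1g^{ -1},\ldots,gA_kg^{ -1})$ on $M_n(\mathbb{F}_q)^k$. Then there exist constants $m_1, m_2 > 0$, independent of $k$, such that $m_1 q^{n^2 k} \le a(n,k,q) \le m_2 q^{n^2 k}$ for all $k$; i.e. $a(n,k,q)$ is asymptotically $q^{n^2k}$ up to a constant factor as $k\to\infty$.
   Context: $\mathbb{F}_q$ is the finite field with $q$ elements, $M_n(\mathbb{F}_q)$ the algebra of $n\times n$ matrices over it, and $GL_n(\mathbb{F}_q)$ its group of units. -}

module Defs where

open import Level using (0ℓ)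
open import Data.Nat using (ℕ; zero; suc)
open import Data.Fin using (Fin; zero; suc)
open import Data.Product using (Σ; ∃; _×_; _,_)
open import Relation.Nullary using (¬_)
open import Relation.Binary.PropositionalEquality using (_≡_)
open import Function.Bundles using (_⇔_)
open import Algebra.Bundles using (CommutativeRing)

record FiniteField (q : ℕ) : Set₁ where
  field
    commRing : CommutativeRing 0ℓ 0ℓ
  open CommutativeRing commRing public
  field
    0≉1      : ¬ (0# ≈ 1#)
    inverse  : ∀ x → ¬ (x ≈ 0#) → ∃ λ y → (x * y) ≈ 1#
    enum     : Fin q → Carrier
    enum-sur : ∀ x → ∃ λ i → enum i ≈ x
    enum-inj : ∀ i j → enum i ≈ enum j → i ≡ j

module Matrices {q : ℕ} (F : FiniteField q) where
  open FiniteField F using (Carrier; _≈_; _+_; _*_; 0#; 1#)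

  Mat : ℕ → Set
  Mat n = Fin n → Fin n → Carrier

  ∑ : ∀ {n} → (Fin n → Carrier) → Carrier
  ∑ {zero}  f = 0#
  ∑ {suc n} f = f zero + ∑ (λ i → f (suc i))

  _·_ : ∀ {n} → Mat n → Mat n → Mat n
  (A · B) i j = ∑ (λ l → A i l * B l j)

  I : ∀ {n} → Mat n
  I {suc n} zero    zero    = 1#
  I {suc n} zero    (suc j) = 0#
  I {suc n} (suc i) zero    = 0#
  I {suc n} (suc i) (suc j) = I i j

  _≋_ : ∀ {n} → Mat n → Mat n → Set
  A ≋ B = ∀ i j → A i j ≈ B i j

  IsInverse : ∀ {n} → Mat n → Mat n → Set
  IsInverse g h = ((g · h) ≋ I) × ((h · g) ≋ I)

  SameOrbit : ∀ n k → (Fin k → Mat n) → (Fin k → Mat n) → Set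
  SameOrbit n k A B =
    Σ (Mat n) λ g → Σ (Mat n) λ h →
      IsInverse g h × (∀ i → ((g · A i) · h) ≋ B i)

-- N is the number of equivalence classes of the relation _~_ on X:
-- there is a map X → Fin N which is surjective and whose fibres are exactly
-- the classes (i.e. it induces a bijection X/~ ≅ Fin N).
IsClassCount : (X : Set) → (X → X → Set) → ℕ → Set
IsClassCount X _~_ N =
  Σ (X → Fin N) λ f →
    (∀ i → ∃ λ x → f x ≡ i) × (∀ x y → (f x ≡ f y) ⇔ (x ~ y))

IsOrbitCount : ∀ {q} → FiniteField q → ℕ → ℕ → ℕ → Set
IsOrbitCount F n k N =
  IsClassCount (Fin k → Mat n) (SameOrbit n k) N
  where open Matrices F

module Submission where

-- Choosing a representative of each orbit injects the orbits into the q^{n²k} tuples of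
-- M_n(F_q)^k, so a(n,k,q) ≤ q^{n²k}.  Conversely
-- every tuple is (g A_i h)_i for the chosen representative A of its orbit and some pair
-- (g, h) ∈ M_n(F_q)², so a tuple is determined by its orbit and that pair, whence
-- q^{n²k} ≤ a(n,k,q) · q^{2n²}.

open import Defs
open import Data.Nat using (ℕ; _^_; _*_; _≥_)
open import Data.Integer using (+_)
open import Data.Rational using (ℚ; Positive; _≤_; _/_) renaming (_*_ to _*ℚ_)
open import Data.Product using (Σ; _×_)

open import Level using (Level; 0ℓ; _⊔_)
open import Data.Nat as ℕ using (zero; suc)
import Data.Nat.Properties as ℕ
open import Data.Nat.Coprimality using (1-coprimeTo) renaming (sym to coprime-sym)
open import Data.Integer as ℤ using ()
import Data.Integer.Properties as ℤ
open import Data.Rational using (mkℚ; 1ℚ; toℚᵘ)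
import Data.Rational.Properties as ℚ
open import Data.Rational.Unnormalised as ℚᵘ using (mkℚᵘ; *≤*)
import Data.Rational.Unnormalised.Properties as ℚᵘ
open import Data.Fin using (Fin; zero; suc; combine; quotient; remainder; funToFin; finToFun)
open import Data.Fin.Properties
  using (remQuot-combine; combine-remQuot; combine-injective; funToFin-finToFin; finToFun-funToFin; injective⇒≤)
open import Data.Product using (∃; _,_; proj₁; proj₂)
open import Data.Product.Relation.Binary.Pointwise.NonDependent using (_×ₛ_)
import Data.Vec.Functional.Relation.Binary.Pointwise.Properties as Pointwise
open import Function.Bundles using (Equivalence)
open import Relation.Binary.Bundles using (Setoid)
open import Relation.Binary.Core using (_⇒_)
open import Relation.Binary.PropositionalEquality as ≡ using (_≡_; cong; cong₂; subst₂)
import Relation.Binary.Reasoning.Setoid as SetoidReasoning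

private
  variable
    c ℓ c′ ℓ′ : Level

record Enumeration (S : Setoid c ℓ) (M : ℕ) : Set (c ⊔ ℓ) where
  open Setoid S
  field
    elem           : Fin M → Carrier
    index          : Carrier → Fin M
    elem-index     : ∀ x → elem (index x) ≈ x
    elem-injective : ∀ {i j} → elem i ≈ elem j → i ≡ j

  index-injective : ∀ {x y} → index x ≡ index y → x ≈ y
  index-injective {x} {y} eq =
    trans (sym (elem-index x)) (trans (reflexive (cong elem eq)) (elem-index y))

funToFin-cong : ∀ {m M} {f g : Fin m → Fin M} → (∀ i → f i ≡ g i) → funToFin f ≡ funToFin g
funToFin-cong {zero}  eq = ≡.refl
funToFin-cong {suc m} eq = cong₂ combine (eq zero) (funToFin-cong (λ i → eq (suc i)))

finToFun-injective : ∀ {m M} {a b : Fin (M ^ m)} → (∀ i → finToFun {M} {m} a i ≡ finToFun b i) → a ≡ b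
finToFun-injective {m} {M} {a} {b} eq = begin
  a                             ≡⟨ funToFin-finToFin {m} {M} a ⟨
  funToFin (finToFun {M} {m} a) ≡⟨ funToFin-cong eq ⟩
  funToFin (finToFun {M} {m} b) ≡⟨ funToFin-finToFin {m} {M} b ⟩
  b                             ∎
  where open ≡.≡-Reasoning

enumeration-Pointwise : ∀ {S : Setoid c ℓ} {M} m → Enumeration S M →
                        Enumeration (Pointwise.setoid S m) (M ^ m)
enumeration-Pointwise {S = S} {M} m E = record
  { elem           = λ a i → elem (finToFun {M} {m} a i)
  ; index          = λ f → funToFin (λ i → index (f i))
  ; elem-index     = λ f i →
      ≡.subst (λ j → elem j ≈ f i) (≡.sym (finToFun-funToFin (λ i → index (f i)) i)) (elem-index (f i))
  ; elem-injective = λ eq → finToFun-injective {m} {M} (λ i → elem-injective (eq i))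
  }
  where
  open Setoid S
  open Enumeration E

enumeration-× : ∀ {S : Setoid c ℓ} {T : Setoid c′ ℓ′} {M K} →
                Enumeration S M → Enumeration T K → Enumeration (S ×ₛ T) (M * K)
enumeration-× {S = S} {T} {M} {K} E D = record
  { elem           = λ a → E.elem (quotient {M} K a) , D.elem (remainder {M} K a)
  ; index          = λ (x , y) → combine (E.index x) (D.index y)
  ; elem-index     = λ (x , y) →
      ≡.subst (λ (i , j) → E.elem i S.≈ x × D.elem j T.≈ y)
              (≡.sym (remQuot-combine (E.index x) (D.index y)))
              (E.elem-index x , D.elem-index y)
  ; elem-injective = λ {a} {b} (eq₁ , eq₂) → begin
      a                                ≡⟨ combine-remQuot {M} K a ⟨
      combine (quotient {M} K a) (remainder {M} K a)
                                       ≡⟨ cong₂ combine (E.elem-injective eq₁) (D.elem-injective eq₂) ⟩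
      combine (quotient {M} K b) (remainder {M} K b)
                                       ≡⟨ combine-remQuot {M} K b ⟩
      b                                ∎
  }
  where
  module S = Setoid S
  module T = Setoid T
  module E = Enumeration E
  module D = Enumeration D
  open ≡.≡-Reasoning

module ClassCount {X : Set} {_~_ : X → X → Set} {N : ℕ} (count : IsClassCount X _~_ N) where

  class : X → Fin N
  class = proj₁ count

  rep : Fin N → X
  rep j = proj₁ (proj₁ (proj₂ count) j)

  class-rep : ∀ j → class (rep j) ≡ j
  class-rep j = proj₂ (proj₁ (proj₂ count) j)

  sameClass⇒related : ∀ {x y} → class x ≡ class y → x ~ y
  sameClass⇒related = Equivalence.to (proj₂ (proj₂ count) _ _)

  related⇒sameClass : ∀ {x y} → x ~ y → class x ≡ class y
  related⇒sameClass = Equivalence.from (proj₂ (proj₂ count) _ _)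

  related-rep : ∀ x → rep (class x) ~ x
  related-rep x = sameClass⇒related (class-rep (class x))

module _ {S : Setoid 0ℓ ℓ} {M : ℕ} (E : Enumeration S M) where
  open Setoid S
  open Enumeration E

  classCount≤size : ∀ {_~_ N} → _≈_ ⇒ _~_ → IsClassCount Carrier _~_ N → N ℕ.≤ M
  classCount≤size ≈⇒~ count = injective⇒≤ indexRep-injective
    where
    open ClassCount count

    indexRep-injective : ∀ {i j} → index (rep i) ≡ index (rep j) → i ≡ j
    indexRep-injective {i} {j} eq = begin
      i                ≡⟨ class-rep i ⟨
      class (rep i)    ≡⟨ related⇒sameClass (≈⇒~ (index-injective eq)) ⟩
      class (rep j)    ≡⟨ class-rep j ⟩
      j                ∎
      where open ≡.≡-Reasoning

  size≤classCount*size : ∀ {G : Setoid c′ ℓ′} {K _~_ N} → Enumeration G K →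
                         (act : Setoid.Carrier G → Carrier → Carrier) →
                         (∀ {g h} x → Setoid._≈_ G g h → act g x ≈ act h x) →
                         (∀ {x y} → x ~ y → ∃ λ g → act g x ≈ y) →
                         IsClassCount Carrier _~_ N → M ℕ.≤ N * K
  size≤classCount*size {K = K} {N = N} D act act-cong ~⇒orbit count = injective⇒≤ code-injective
    where
    open ClassCount count
    module D = Enumeration D

    witness : ∀ i → ∃ λ g → act g (rep (class (elem i))) ≈ elem i
    witness i = ~⇒orbit (related-rep (elem i))

    code : Fin M → Fin (N * K)
    code i = combine (class (elem i)) (D.index (proj₁ (witness i)))

    code-injective : ∀ {i j} → code i ≡ code j → i ≡ j
    code-injective {i} {j} eq with combine-injective _ _ _ _ eq
    ... | sameClass , sameWitness = elem-injective (begin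
      elem i                                         ≈⟨ proj₂ (witness i) ⟨
      act (proj₁ (witness i)) (rep (class (elem i))) ≈⟨ act-cong _ (D.index-injective sameWitness) ⟩
      act (proj₁ (witness j)) (rep (class (elem i))) ≡⟨ cong (λ k → act (proj₁ (witness j)) (rep k)) sameClass ⟩
      act (proj₁ (witness j)) (rep (class (elem j))) ≈⟨ proj₂ (witness j) ⟩
      elem j                                         ∎)
      where open SetoidReasoning S

module _ {q : ℕ} (F : FiniteField q) where
  open FiniteField F hiding (zero) renaming (_*_ to _*ᶠ_)
  open Matrices F

  fieldEnumeration : Enumeration setoid q
  fieldEnumeration = record
    { elem           = enum
    ; index          = λ x → proj₁ (enum-sur x)
    ; elem-index     = λ x → proj₂ (enum-sur x)
    ; elem-injective = enum-inj _ _
    }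

  matrixSetoid : ℕ → Setoid 0ℓ 0ℓ
  matrixSetoid n = Pointwise.setoid (Pointwise.setoid setoid n) n

  matrixEnumeration : ∀ n → Enumeration (matrixSetoid n) ((q ^ n) ^ n)
  matrixEnumeration n = enumeration-Pointwise n (enumeration-Pointwise n fieldEnumeration)

  ∑-cong : ∀ {m} {f g : Fin m → Carrier} → (∀ i → f i ≈ g i) → ∑ f ≈ ∑ g
  ∑-cong {zero}  eq = refl
  ∑-cong {suc m} eq = +-cong (eq zero) (∑-cong (λ i → eq (suc i)))

  ∑-zero : ∀ {m} {f : Fin m → Carrier} → (∀ i → f i ≈ 0#) → ∑ f ≈ 0#
  ∑-zero {zero}  eq = refl
  ∑-zero {suc m} eq = trans (+-cong (eq zero) (∑-zero (λ i → eq (suc i)))) (+-identityˡ 0#)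

  ·-cong : ∀ {m} {A A′ B B′ : Mat m} → A ≋ A′ → B ≋ B′ → (A · B) ≋ (A′ · B′)
  ·-cong A≋A′ B≋B′ i j = ∑-cong (λ l → *-cong (A≋A′ i l) (B≋B′ l j))

  ∑-I-* : ∀ {m} (v : Fin m → Carrier) i → ∑ (λ l → I i l *ᶠ v l) ≈ v i
  ∑-I-* {suc m} v zero    =
    trans (+-cong (*-identityˡ _) (∑-zero (λ l → zeroˡ (v (suc l))))) (+-identityʳ _)
  ∑-I-* {suc m} v (suc i) =
    trans (+-cong (zeroˡ _) (∑-I-* (λ l → v (suc l)) i)) (+-identityˡ _)

  ∑-*-I : ∀ {m} (v : Fin m → Carrier) j → ∑ (λ l → v l *ᶠ I l j) ≈ v j
  ∑-*-I {suc m} v zero    =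
    trans (+-cong (*-identityʳ _) (∑-zero (λ l → zeroʳ (v (suc l))))) (+-identityʳ _)
  ∑-*-I {suc m} v (suc j) =
    trans (+-cong (zeroʳ _) (∑-*-I (λ l → v (suc l)) j)) (+-identityˡ _)

  ·-identityˡ : ∀ {m} (A : Mat m) → (I · A) ≋ A
  ·-identityˡ A i j = ∑-I-* (λ l → A l j) i

  ·-identityʳ : ∀ {m} (A : Mat m) → (A · I) ≋ A
  ·-identityʳ A i j = ∑-*-I (A i) j

  module _ (n k : ℕ) where

    tupleSetoid : Setoid 0ℓ 0ℓ
    tupleSetoid = Pointwise.setoid (matrixSetoid n) k

    tupleEnumeration : Enumeration tupleSetoid (((q ^ n) ^ n) ^ k)
    tupleEnumeration = enumeration-Pointwise k (matrixEnumeration n)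

    sandwich : Mat n × Mat n → (Fin k → Mat n) → (Fin k → Mat n)
    sandwich (g , h) A i = (g · A i) · h

    sandwich-cong : ∀ {gh gh′} A → Setoid._≈_ (matrixSetoid n ×ₛ matrixSetoid n) gh gh′ →
                    (∀ i → sandwich gh A i ≋ sandwich gh′ A i)
    sandwich-cong A (g≋g′ , h≋h′) i = ·-cong (·-cong g≋g′ (λ _ _ → refl)) h≋h′

    SameOrbit⇒sandwich : ∀ {A B} → SameOrbit n k A B → ∃ λ gh → ∀ i → sandwich gh A i ≋ B i
    SameOrbit⇒sandwich (g , h , _ , gAh≋B) = (g , h) , gAh≋B

    ≋⇒SameOrbit : ∀ {A B} → (∀ i → A i ≋ B i) → SameOrbit n k A B
    ≋⇒SameOrbit {A} A≋B = I , I , (·-identityˡ I , ·-identityˡ I) , λ i a b →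
      trans (·-identityʳ (I · A i) a b) (trans (·-identityˡ (A i) a b) (A≋B i a b))

    orbitCount≤tupleCount : ∀ {N} → IsOrbitCount F n k N → N ℕ.≤ ((q ^ n) ^ n) ^ k
    orbitCount≤tupleCount = classCount≤size tupleEnumeration ≋⇒SameOrbit

    tupleCount≤orbitCount* : ∀ {N} → IsOrbitCount F n k N →
                   ((q ^ n) ^ n) ^ k ℕ.≤ N * ((q ^ n) ^ n * (q ^ n) ^ n)
    tupleCount≤orbitCount* = size≤classCount*size tupleEnumeration
      (enumeration-× (matrixEnumeration n) (matrixEnumeration n))
      sandwich sandwich-cong SameOrbit⇒sandwich

-- (+ a) / 1 normalises through gcd a 1, which does not reduce for a variable a.
toℚᵘ-/1 : ∀ a → toℚᵘ ((+ a) / 1) ≡ mkℚᵘ (+ a) 0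
toℚᵘ-/1 a = cong toℚᵘ (ℚ.↥p/↧p≡p (mkℚ (+ a) 0 (coprime-sym (1-coprimeTo a))))

1/suc : ℕ → ℚ
1/suc d = mkℚ (+ 1) d (1-coprimeTo (suc d))

1/suc-*-/1-≤ : ∀ d {a b} → a ℕ.≤ b * suc d → 1/suc d *ℚ ((+ a) / 1) ≤ (+ b) / 1
1/suc-*-/1-≤ d {a} {b} a≤b*[1+d] =
  ℚ.toℚᵘ-cancel-≤ (ℚᵘ.≤-respˡ-≃ (ℚᵘ.≃-sym (ℚ.toℚᵘ-homo-* (1/suc d) ((+ a) / 1))) unnormalised)
  where
  lhs : (+ 1 ℤ.* + a) ℤ.* + 1 ≡ + a
  lhs = ≡.trans (ℤ.*-identityʳ _) (ℤ.*-identityˡ (+ a))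

  rhs : + b ℤ.* + (suc d * 1) ≡ + (b * suc d)
  rhs = ≡.trans (≡.sym (ℤ.pos-* b _)) (cong (λ m → + (b * m)) (ℕ.*-identityʳ (suc d)))

  unnormalised : mkℚᵘ (+ 1) d ℚᵘ.* toℚᵘ ((+ a) / 1) ℚᵘ.≤ toℚᵘ ((+ b) / 1)
  unnormalised rewrite toℚᵘ-/1 a | toℚᵘ-/1 b =
    *≤* (subst₂ ℤ._≤_ (≡.sym lhs) (≡.sym rhs) (ℤ.+≤+ a≤b*[1+d]))

/1-≤-1ℚ*-/1 : ∀ {a b} → a ℕ.≤ b → (+ a) / 1 ≤ 1ℚ *ℚ ((+ b) / 1)
/1-≤-1ℚ*-/1 {a} {b} a≤b = subst₂ _≤_ (ℚ.*-identityˡ _) (≡.sym (ℚ.*-identityˡ _))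
  (1/suc-*-/1-≤ 0 {a} {b} (≡.subst (a ℕ.≤_) (≡.sym (ℕ.*-identityʳ b)) a≤b))

claim1 : (n : ℕ) → n ≥ 1 → (q : ℕ) → (F : FiniteField q) →
    Σ ℚ λ m₁ → Σ ℚ λ m₂ → Positive m₁ × Positive m₂ ×
      ((k : ℕ) → k ≥ 1 → (N : ℕ) → IsOrbitCount F n k N →
        (m₁ *ℚ ((+ (q ^ (n * n * k))) / 1) ≤ ((+ N) / 1))
        × (((+ N) / 1) ≤ m₂ *ℚ ((+ (q ^ (n * n * k))) / 1)))
-- The denominator 1 + q^{2n²} rather than q^{2n²} spares a proof that q ≠ 0.
claim1 n _ q F = 1/suc (Q * Q) , 1ℚ , _ , _ , λ k _ N count →
    1/suc-*-/1-≤ (Q * Q) {b = N} (lower k count) , /1-≤-1ℚ*-/1 {a = N} (upper k count)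
  where
  Q : ℕ
  Q = (q ^ n) ^ n

  tupleCount≡ : ∀ k → Q ^ k ≡ q ^ (n * n * k)
  tupleCount≡ k = ≡.trans (cong (_^ k) (ℕ.^-*-assoc q n n)) (ℕ.^-*-assoc q (n * n) k)

  lower : ∀ k {N} → IsOrbitCount F n k N → q ^ (n * n * k) ℕ.≤ N * suc (Q * Q)
  lower k {N} count = ≡.subst (ℕ._≤ N * suc (Q * Q)) (tupleCount≡ k)
    (ℕ.≤-trans (tupleCount≤orbitCount* F n k count) (ℕ.*-monoʳ-≤ N (ℕ.n≤1+n (Q * Q))))

  upper : ∀ k {N} → IsOrbitCount F n k N → N ℕ.≤ q ^ (n * n * k)
  upper k {N} count = ≡.subst (N ℕ.≤_) (tupleCount≡ k) (orbitCount≤tupleCount F n k count)
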